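{- Let $\mathcal{G}$ be a reachability game and $s$ a state. If REACH (respectively SAFE) has a winning symbolic strategy in $s$, then REACH (respectively SAFE) has a (concrete) winning strategy from $s$.
   Context: Fix a logic $\mathcal{L}$ and a finite set of variables $\mathcal{V}$ with domains, primed copies $\mathcal{V}'$, and a Boolean variable $\mathbf{r}\in\mathcal{V}$. A state is a valuation of $\mathcal{V}$ respecting domains; $S$ is the set of states, $S_{\mathrm{REACH}}=\{s:s(\mathbf{r})=\mathrm{true}\}$, $S_{\mathrm{SAFE}}=S\setminus S_{\mathrm{REACH}}$; $\varphi(s)$, $\tau(s,s')$ denote evaluation of state/transition predicates (formulas over $\mathcal{V}$, resp. $\mathcal{V}\cup\mathcal{V}'$), and $\tau(s)$ substitutes only unprimed variables. A reachability game $\mathcal{G}=\langle \mathit{Init},\mathit{Safe},\mathit{Reach},\mathit{Goal}\rangle$ has state predicates $\mathit{Init},\mathit{Goal}$ and transition predicates $\mathit{Safe},\mathit{Reach}$ with $\mathit{Safe}\Rightarrow\neg\mathbf{r}$, $\mathit{Reach}\Rightarrow\mathbf{r}$ valid. A trap state is $s$ with $(\mathit{Safe}\lor\mathit{Reach})(s)$ unsatisfiable. A play from $s_0$ is a finite or infinite sequence $s_0s_1\ldots$ with $\mathit{Safe}(s_i,s_{i+1})$ or $\mathit{Reach}(s_i,s_{i+1})$ for consecutive pairs, ending in a trap state if finite. REACH wins a play if some state on it satisfies $\mathit{Goal}$, otherwise SAFE wins. A (concrete) reachability strategy is $\sigma_R:S^*S_{\mathrm{REACH}}\to S$ with $\mathit{Reach}(s,\sigma_R(ws))$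 whenever $s$ is not a trap; safety strategies analogously with $S_{\mathrm{SAFE}}$, $\mathit{Safe}$. A play is consistent with a strategy if its owner moves as prescribed; a strategy is winning from $s$ if its owner wins every consistent play from $s$. A symbolic strategy is a transition predicate $\mathfrak{S}$ with $\mathfrak{S}\Rightarrow(\mathit{Safe}\lor\mathit{Reach})$ valid. A play prefix is a finite sequence $s_0\ldots s_n$ that is a prefix of some play, such that $\neg\mathit{Goal}(s_j)$ for all $j\le n$ and $s_n$ is not a trap state. A play prefix conforms to a symbolic reachability strategy $\mathfrak{S}$ if $\mathfrak{S}(s_j,s_{j+1})$ holds for every $j<n$ with $s_j\in S_{\mathrm{REACH}}$ (analogously for safety with $S_{\mathrm{SAFE}}$); a play conforms if all its play prefixes conform. $\mathfrak{S}$ is winning for REACH in $s$ if all plays from $s$ conforming to $\mathfrak{S}$ are won by REACH and every play prefix $s_0\ldots s_n$ with $s_0=s$, $s_n\in S_{\mathrm{REACH}}$ conforming to $\mathfrak{S}$ has $(\mathfrak{S}\land\mathit{Reach})(s_n)$ satisfiable; analogously for SAFE (plays won by SAFE, and $(\mathfrak{S}\land\mathit{Safe})(s_n)$ satisfiable for conforming prefixes ending in $S_{\mathrm{SAFE}}$). -}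

module Defs where

open import Data.Nat using (ℕ; zero; suc; _≤_; _<_)
open import Data.Fin using (Fin)
open import Data.Bool using (Bool; true; false)
open import Data.List using (List; map)
open import Data.List.Base using (upTo)
open import Data.Maybe using (Maybe; just; nothing)
open import Data.Product using (Σ; _×_; _,_; proj₁)
open import Data.Sum using (_⊎_)
open import Data.Unit using (⊤)
open import Relation.Nullary using (¬_)
open import Relation.Binary.PropositionalEquality using (_≡_)

-- The variable set V consists of the distinguished Boolean variable r
-- together with finitely many further variables x₀ … x_{n-1}, each with
-- its own domain Dom xᵢ.

record Vocabulary : Set₁ where
  field
    n   : ℕ
    Dom : Fin n → Set

State : Vocabulary → Set
State V = Bool × ((x : Fin (Vocabulary.n V)) → Vocabulary.Dom V x)

r : {V : Vocabulary} → State V → Bool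
r = proj₁

record Logic (St : Set) : Set₁ where
  field
    StateFormula : Set
    TransFormula : Set
    ⟦_⟧ˢ : StateFormula → St → Bool
    ⟦_⟧ᵗ : TransFormula → St → St → Bool

record Game (V : Vocabulary) (L : Logic (State V)) : Set where
  open Logic L
  field
    Init  : StateFormula
    Safe  : TransFormula
    Reach : TransFormula
    Goal  : StateFormula
    Safe⇒¬r : ∀ s s' → ⟦ Safe ⟧ᵗ s s' ≡ true → r s ≡ false
    Reach⇒r : ∀ s s' → ⟦ Reach ⟧ᵗ s s' ≡ true → r s ≡ true

module GameDefs {V : Vocabulary} {L : Logic (State V)} (G : Game V L) where
  open Logic L
  open Game G

  S : Set
  S = State V

  Move : S → S → Set
  Move s s' = (⟦ Safe ⟧ᵗ s s' ≡ true) ⊎ (⟦ Reach ⟧ᵗ s s' ≡ true)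

  Trap : S → Set
  Trap s = ¬ Σ S (λ s' → Move s s')

  -- index i lies on a play of the given end (nothing = infinite play,
  -- just m = finite play s₀ … s_m)
  InRange : Maybe ℕ → ℕ → Set
  InRange nothing  i = ⊤
  InRange (just m) i = i ≤ m

  -- a (finite or infinite) play from s; for a finite play ending at index
  -- m the values π i for i > m are irrelevant
  record Play (s : S) : Set where
    field
      π     : ℕ → S
      end   : Maybe ℕ
      start : π 0 ≡ s
      step  : ∀ i → InRange end (suc i) → Move (π i) (π (suc i))
      final : ∀ m → end ≡ just m → Trap (π m)
  open Play public

  ReachWins : {s : S} → Play s → Set
  ReachWins P = Σ ℕ (λ i → InRange (end P) i × ⟦ Goal ⟧ˢ (π P i) ≡ true)

  SafeWins : {s : S} → Play s → Set
  SafeWins P = ¬ ReachWins P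

  history : (ℕ → S) → ℕ → List S
  history p i = map p (upTo i)

  record ReachStrategy : Set where
    field
      σ    : List S → (s : S) → r s ≡ true → S
      legal : ∀ w s (h : r s ≡ true) → ¬ Trap s → ⟦ Reach ⟧ᵗ s (σ w s h) ≡ true

  record SafeStrategy : Set where
    field
      σ    : List S → (s : S) → r s ≡ false → S
      legal : ∀ w s (h : r s ≡ false) → ¬ Trap s → ⟦ Safe ⟧ᵗ s (σ w s h) ≡ true

  ConsistentR : ReachStrategy → {s : S} → Play s → Set
  ConsistentR σR P = ∀ i → InRange (end P) (suc i) → (h : r (π P i) ≡ true) →
    π P (suc i) ≡ ReachStrategy.σ σR (history (π P) i) (π P i) h

  ConsistentS : SafeStrategy → {s : S} → Play s → Set
  ConsistentS σS P = ∀ i → InRange (end P) (suc i) → (h : r (π P i) ≡ false) →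
    π P (suc i) ≡ SafeStrategy.σ σS (history (π P) i) (π P i) h

  WinningReach : ReachStrategy → S → Set
  WinningReach σR s = (P : Play s) → ConsistentR σR P → ReachWins P

  WinningSafe : SafeStrategy → S → Set
  WinningSafe σS s = (P : Play s) → ConsistentS σS P → SafeWins P

  IsSymbolicStrategy : TransFormula → Set
  IsSymbolicStrategy 𝔖 = ∀ s s' → ⟦ 𝔖 ⟧ᵗ s s' ≡ true → Move s s'

  IsPlayPrefix : ℕ → (ℕ → S) → Set
  IsPlayPrefix m p =
    Σ (Play (p 0)) (λ P → InRange (end P) m × (∀ i → i ≤ m → π P i ≡ p i))
    × (∀ j → j ≤ m → ⟦ Goal ⟧ˢ (p j) ≡ false)
    × ¬ Trap (p m)

  ConformsPrefixR : TransFormula → ℕ → (ℕ → S) → Set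
  ConformsPrefixR 𝔖 m p = ∀ j → j < m → r (p j) ≡ true → ⟦ 𝔖 ⟧ᵗ (p j) (p (suc j)) ≡ true

  ConformsPrefixS : TransFormula → ℕ → (ℕ → S) → Set
  ConformsPrefixS 𝔖 m p = ∀ j → j < m → r (p j) ≡ false → ⟦ 𝔖 ⟧ᵗ (p j) (p (suc j)) ≡ true

  ConformsPlayR : TransFormula → {s : S} → Play s → Set
  ConformsPlayR 𝔖 P = ∀ m → IsPlayPrefix m (π P) → ConformsPrefixR 𝔖 m (π P)

  ConformsPlayS : TransFormula → {s : S} → Play s → Set
  ConformsPlayS 𝔖 P = ∀ m → IsPlayPrefix m (π P) → ConformsPrefixS 𝔖 m (π P)

  WinningSymbolicReach : TransFormula → S → Set
  WinningSymbolicReach 𝔖 s =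
    ((P : Play s) → ConformsPlayR 𝔖 P → ReachWins P)
    × (∀ m (p : ℕ → S) → p 0 ≡ s → IsPlayPrefix m p → ConformsPrefixR 𝔖 m p →
         r (p m) ≡ true →
         Σ S (λ s' → ⟦ 𝔖 ⟧ᵗ (p m) s' ≡ true × ⟦ Reach ⟧ᵗ (p m) s' ≡ true))

  WinningSymbolicSafe : TransFormula → S → Set
  WinningSymbolicSafe 𝔖 s =
    ((P : Play s) → ConformsPlayS 𝔖 P → SafeWins P)
    × (∀ m (p : ℕ → S) → p 0 ≡ s → IsPlayPrefix m p → ConformsPrefixS 𝔖 m p →
         r (p m) ≡ false →
         Σ S (λ s' → ⟦ 𝔖 ⟧ᵗ (p m) s' ≡ true × ⟦ Safe ⟧ᵗ (p m) s' ≡ true))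

module Submission where

open import Defs
open import Level using (0ℓ)
open import Axiom.ExcludedMiddle using (ExcludedMiddle)
open import Data.Bool using (Bool; true; false)
open import Data.Empty using (⊥-elim)
open import Data.List using (List)
open import Data.Maybe using (Maybe; just; nothing)
open import Data.Nat using (ℕ; zero; suc; _≤_; _<_; _≤?_)
open import Data.Nat.Properties using (≤-refl; ≤-trans; <⇒≤; ≰⇒>; <-≤-trans; m<1+n⇒m<n∨m≡n)
open import Data.Product using (Σ; _×_; _,_; proj₁; proj₂)
open import Data.Sum using (inj₁; inj₂)
open import Data.Unit using (tt)
open import Relation.Nullary using (¬_; Dec; yes; no)
open import Relation.Binary.PropositionalEquality using (_≡_; refl; sym; trans; subst; subst₂)

-- Proof idea: the concrete strategy is positional and simply picks, at
-- each of its owner's states, a successor allowed by the symbolic strategy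
-- 𝔖 (falling back to an arbitrary legal move, or to the state itself at a
-- trap).  By induction on the length of play prefixes, every play
-- consistent with it conforms to 𝔖: the second clause of symbolic
-- winningness guarantees that at each conforming prefix a 𝔖-move exists,
-- so the strategy takes one.  Hence all consistent plays are won by the
-- first clause.  Excluded middle is needed only to choose the successors.

module _ {V : Vocabulary} {L : Logic (State V)} (G : Game V L) where
  open Logic L
  open Game G
  open GameDefs G

  InRange-≤ : ∀ {e : Maybe ℕ} {i j} → i ≤ j → InRange e j → InRange e i
  InRange-≤ {nothing} _   _   = tt
  InRange-≤ {just k}  i≤j j≤k = ≤-trans i≤j j≤k

  module _ {m : ℕ} {p : ℕ → S} (pre : IsPlayPrefix m p) where
    private
      P     = proj₁ (proj₁ pre)
      range = proj₁ (proj₂ (proj₁ pre))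
      agree = proj₂ (proj₂ (proj₁ pre))

    IsPlayPrefix-move : ∀ {j} → j < m → Move (p j) (p (suc j))
    IsPlayPrefix-move {j} j<m =
      subst₂ Move (agree j (<⇒≤ j<m)) (agree (suc j) j<m) (step P j (InRange-≤ j<m range))

    IsPlayPrefix-shorten : ∀ {j} → j < m → IsPlayPrefix j p
    IsPlayPrefix-shorten {j} j<m =
        (P , InRange-≤ (<⇒≤ j<m) range , λ i i≤j → agree i (≤-trans i≤j (<⇒≤ j<m)))
      , (λ i i≤j → proj₁ (proj₂ pre) i (≤-trans i≤j (<⇒≤ j<m)))
      , λ trap → trap (p (suc j) , IsPlayPrefix-move j<m)

  -- A play cannot end strictly inside one of its own play prefixes.
  IsPlayPrefix⇒InRange : ∀ {s m i} (P : Play s) → IsPlayPrefix m (π P) → i ≤ m → InRange (end P) i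
  IsPlayPrefix⇒InRange P pre i≤m with end P in ends
  ... | nothing = tt
  ... | just k with _ ≤? k
  ...   | yes i≤k = i≤k
  ...   | no  i≰k = ⊥-elim (final P k ends (_ , IsPlayPrefix-move pre (<-≤-trans (≰⇒> i≰k) i≤m)))

  choose : {A : S → Set} → Dec (Σ S A) → S → S
  choose (yes (t , _)) _ = t
  choose (no _)        d = d

  choose-sound : {A : S → Set} (dec : Dec (Σ S A)) (d : S) → Σ S A → A (choose dec d)
  choose-sound (yes (_ , a)) _ _ = a
  choose-sound (no ∄)        _ ∃ = ⊥-elim (∄ ∃)

  choose-preserves : {A : S → Set} (Q : S → Set) (dec : Dec (Σ S A)) (d : S) →
                     (∀ t → A t → Q t) → Q d → Q (choose dec d)
  choose-preserves Q (yes (t , a)) _ A⇒Q _  = A⇒Q t a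
  choose-preserves Q (no _)        _ _   Qd = Qd

  Move⇒Reach : ∀ x y → r x ≡ true → Move x y → ⟦ Reach ⟧ᵗ x y ≡ true
  Move⇒Reach x y rx (inj₁ safe)  with () ← trans (sym rx) (Safe⇒¬r x y safe)
  Move⇒Reach _ _ _  (inj₂ reach) = reach

  Move⇒Safe : ∀ x y → r x ≡ false → Move x y → ⟦ Safe ⟧ᵗ x y ≡ true
  Move⇒Safe _ _ _  (inj₁ safe)  = safe
  Move⇒Safe x y rx (inj₂ reach) with () ← trans (sym (Reach⇒r x y reach)) rx

  -- The player owning the states with r = b and moving along T; the
  -- hypothesis says every move from such a state is a T-move.
  module Concretize (em : ExcludedMiddle 0ℓ) (b : Bool) (T : TransFormula)
         (Move⇒T : ∀ x y → r x ≡ b → Move x y → ⟦ T ⟧ᵗ x y ≡ true)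
         (𝔖 : TransFormula) where

    T-Successor : S → S → Set
    T-Successor x y = ⟦ T ⟧ᵗ x y ≡ true

    𝔖T-Successor : S → S → Set
    𝔖T-Successor x y = ⟦ 𝔖 ⟧ᵗ x y ≡ true × T-Successor x y

    σ : List S → (x : S) → r x ≡ b → S
    σ _ x _ = choose {𝔖T-Successor x} em (choose {T-Successor x} em x)

    σ-follows-𝔖 : ∀ w x (h : r x ≡ b) → Σ S (𝔖T-Successor x) → ⟦ 𝔖 ⟧ᵗ x (σ w x h) ≡ true
    σ-follows-𝔖 _ x _ ∃𝔖T = proj₁ (choose-sound em _ ∃𝔖T)

    σ-legal : ∀ w x (h : r x ≡ b) → ¬ Trap x → T-Successor x (σ w x h)
    σ-legal _ x h ¬trap =
      choose-preserves (T-Successor x) em _ (λ _ → proj₂) (choose-sound em x ∃T)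
      where
      ∃T : Σ S (T-Successor x)
      ∃T with em {Σ S (Move x)}
      ... | yes (y , move) = y , Move⇒T x y h move
      ... | no  ∄move      = ⊥-elim (¬trap ∄move)

    Conforms : ℕ → (ℕ → S) → Set
    Conforms m p = ∀ j → j < m → r (p j) ≡ b → ⟦ 𝔖 ⟧ᵗ (p j) (p (suc j)) ≡ true

    NonBlocking : S → Set
    NonBlocking s = ∀ m (p : ℕ → S) → p 0 ≡ s → IsPlayPrefix m p → Conforms m p →
                    r (p m) ≡ b → Σ S (𝔖T-Successor (p m))

    Consistent : {s : S} → Play s → Set
    Consistent P = ∀ i → InRange (end P) (suc i) → (h : r (π P i) ≡ b) →
                   π P (suc i) ≡ σ (history (π P) i) (π P i) h

    consistent⇒conforms : ∀ {s} → NonBlocking s → (P : Play s) → Consistent P →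
                          ∀ m → IsPlayPrefix m (π P) → Conforms m (π P)
    consistent⇒conforms _   _ _    zero    _   _ ()
    consistent⇒conforms nb  P cons (suc m) pre j j<1+m rj with m<1+n⇒m<n∨m≡n j<1+m
    ... | inj₁ j<m  = consistent⇒conforms nb P cons m (IsPlayPrefix-shorten pre ≤-refl) j j<m rj
    ... | inj₂ refl =
      subst (λ y → ⟦ 𝔖 ⟧ᵗ (π P m) y ≡ true)
            (sym (cons m (IsPlayPrefix⇒InRange P pre ≤-refl) rj))
            (σ-follows-𝔖 (history (π P) m) (π P m) rj
              (nb m (π P) (start P) pre-m (consistent⇒conforms nb P cons m pre-m) rj))
      where
      pre-m : IsPlayPrefix m (π P)
      pre-m = IsPlayPrefix-shorten pre ≤-refl

lemma3 : ExcludedMiddle 0ℓ →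
    (V : Vocabulary) (L : Logic (State V)) (G : Game V L) (s : State V) →
    (Σ (Logic.TransFormula L) (λ 𝔖 → GameDefs.IsSymbolicStrategy G 𝔖 × GameDefs.WinningSymbolicReach G 𝔖 s)
    → Σ (GameDefs.ReachStrategy G) (λ σ → GameDefs.WinningReach G σ s))
    × (Σ (Logic.TransFormula L) (λ 𝔖 → GameDefs.IsSymbolicStrategy G 𝔖 × GameDefs.WinningSymbolicSafe G 𝔖 s)
    → Σ (GameDefs.SafeStrategy G) (λ σ → GameDefs.WinningSafe G σ s))
lemma3 em V L G s = reach , safe
  where
  open Logic L
  open Game G
  open GameDefs G

  reach : Σ TransFormula (λ 𝔖 → IsSymbolicStrategy 𝔖 × WinningSymbolicReach 𝔖 s)
        → Σ ReachStrategy (λ σ → WinningReach σ s)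
  reach (𝔖 , _ , conformingWins , nonBlocking) =
      record { σ = σ ; legal = σ-legal }
    , λ P cons → conformingWins P (consistent⇒conforms nonBlocking P cons)
    where open Concretize G em true Reach (Move⇒Reach G) 𝔖

  safe : Σ TransFormula (λ 𝔖 → IsSymbolicStrategy 𝔖 × WinningSymbolicSafe 𝔖 s)
       → Σ SafeStrategy (λ σ → WinningSafe σ s)
  safe (𝔖 , _ , conformingWins , nonBlocking) =
      record { σ = σ ; legal = σ-legal }
    , λ P cons → conformingWins P (consistent⇒conforms nonBlocking P cons)
    where open Concretize G em false Safe (Move⇒Safe G) 𝔖
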